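{- Let $n\ge 1$ be an integer, let $\omega(n)$ be the number of $1$s in the binary expansion of $n$, and let $R(n)=\{\rho : \text{the } \rho\text{ -th binary digit of } n \text{ equals } 1\}$, so that $n=\sum_{\rho\in R(n)}2^{\rho}$ and $|R(n)|=\omega(n)$. A full binary tree $T$ with $n$ leaves has the maximum number of $S$-nodes (equivalently, the minimum number of $D$-nodes) among all full binary trees with $n$ leaves if and only if $T$ can be obtained from some full binary tree $B$ with $\omega(n)$ leaves by replacing the $\omega(n)$ leaves of $B$, bijectively, by the $\omega(n)$ perfect binary trees with $2^{\rho}$ leaves, $\rho\in R(n)$ (each leaf of $B$ is replaced by the root of the corresponding perfect tree).
   Context: A full binary tree is a rooted tree in which every node has either $0$ or $2$ children; trees are considered up to isomorphism (swapping the two children of any nodes). For an internal node, its two children have some numbers of descendant leaves; the node is an $S$-node if these two numbers are equal and a $D$-node otherwise. A perfect binary tree with $2^k$ leaves is the full binary tree in which all leaves are at depth $k$ (the tree with $2^0=1$ leaf is a single node). -}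

module Defs where

open import Data.Nat using (ℕ; zero; suc; _+_; _≤_)
open import Relation.Binary.PropositionalEquality using (_≡_)
open import Data.Nat.Properties using (_≟_)
open import Data.Nat.DivMod using (_/_; _%_)
open import Data.List using (List; []; _∷_; filter; upTo; length; take; drop)
open import Relation.Nullary using (yes; no)

data Tree : Set where
  leaf : Tree
  node : Tree → Tree → Tree

-- Isomorphism of full binary trees: equality up to swapping the two
-- children of any nodes.
data _≅_ : Tree → Tree → Set where
  leaf≅ : leaf ≅ leaf
  keep  : ∀ {a b c d} → a ≅ c → b ≅ d → node a b ≅ node c d
  swap  : ∀ {a b c d} → a ≅ d → b ≅ c → node a b ≅ node c d

leaves : Tree → ℕ
leaves leaf       = 1
leaves (node l r) = leaves l + leaves r

sNodes : Tree → ℕ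
sNodes leaf = 0
sNodes (node l r) with leaves l ≟ leaves r
... | yes _ = suc (sNodes l + sNodes r)
... | no  _ = sNodes l + sNodes r

perfect : ℕ → Tree
perfect zero    = leaf
perfect (suc k) = node (perfect k) (perfect k)

digit : ℕ → ℕ → ℕ
digit n zero    = n % 2
digit n (suc ρ) = digit (n / 2) ρ

-- R(n) = { ρ : the ρ-th binary digit of n is 1 }, listed increasingly.
-- Positions ρ > n never qualify (2^ρ > n), so searching 0..n suffices.
R : ℕ → List ℕ
R n = filter (λ ρ → digit n ρ ≟ 1) (upTo (suc n))

ω : ℕ → ℕ
ω n = length (R n)

graft : Tree → List Tree → Tree
graft leaf []          = leaf
graft leaf (t ∷ _)     = t
graft (node l r) ts    = node (graft l (take (leaves l) ts)) (graft r (drop (leaves l) ts))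

MaxS : ℕ → Tree → Set
MaxS n T = ∀ T′ → leaves T′ ≡ n → sNodes T′ ≤ sNodes T

{-# OPTIONS --safe #-}
-- Since a tree with n leaves has n − 1 internal nodes, maximising S-nodes means minimising
-- D-nodes. By induction D(T) ≥ ω(n) − 1: at an S-node ω(a + a) = ω(a), and at a D-node
-- ω(a + b) ≤ ω(a) + ω(b) because every carry in the binary addition loses a 1. Grafting the
-- perfect trees 2^ρ, ρ ∈ R(n), onto any tree B with ω(n) leaves attains the bound, since only
-- the ω(n) − 1 internal nodes of B can be D-nodes. Conversely, in a tree attaining the bound
-- equality propagates to the children: at a D-node the addition a + b is carry-free, so
-- R(a + b) = R(a) ⊎ R(b) and the two decompositions combine; at an S-node neither child has a
-- D-node, so both are the same perfect tree and so is the node itself.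
module Submission where

open import Data.Bool using (true; false)
open import Data.Empty using (⊥-elim)
open import Data.List using (List; []; _∷_; _++_; map; filter; length; upTo; take; drop)
open import Data.List.Properties
  using (length-map; map-++; map-upTo; filter-accept; filter-reject; length-take; length-drop; take++drop≡id)
open import Data.List.Relation.Binary.Permutation.Propositional
  using (_↭_; ↭-refl; ↭-sym; ↭-trans; ↭-reflexive; prep; module PermutationReasoning)
open import Data.List.Relation.Binary.Permutation.Propositional.Properties
  using (map⁺; shift; ++⁺; ↭-length; ↭-singleton-inv; All-resp-↭)
open import Data.List.Relation.Unary.All using (All; []; _∷_; universal)
open import Data.List.Relation.Unary.All.Properties using (take⁺; drop⁺) renaming (map⁺ to All-map⁺)
open import Data.Nat using (ℕ; zero; suc; _+_; _*_; _^_; _∸_; _⊓_; _≤_; _≤′_; ≤′-reflexive; ≤′-step; z≤n; s≤s)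
open import Data.Nat.DivMod using (_/_; _%_; m*n%n≡0; [m+kn]%n≡m%n; m*n/n≡m; +-distrib-/-∣ʳ)
open import Data.Nat.Divisibility using (divides-refl)
open import Data.Nat.ListAction using (sum)
open import Data.Nat.ListAction.Properties using (sum-++)
open import Data.Nat.Properties
open import Data.Nat.Tactic.RingSolver using (solve-∀)
open import Data.Product using (Σ; _×_; _,_; proj₁; proj₂)
open import Function.Base using (_∘_)
open import Function.Bundles using (_⇔_; mk⇔)
open import Relation.Binary.PropositionalEquality
open import Relation.Nullary using (does; Dec; yes; no; ¬_)
open import Relation.Unary using (Pred; Decidable)

open import Defs

x+x≡x*2 : ∀ x → x + x ≡ x * 2
x+x≡x*2 x = sym (trans (*-suc x 1) (cong (x +_) (*-identityʳ x)))

x+x≤1+m⇒x≤m : ∀ {x m} → x + x ≤ suc m → x ≤ m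
x+x≤1+m⇒x≤m {zero}  _ = z≤n
x+x≤1+m⇒x≤m {suc x} (s≤s le) = m+n≤o⇒n≤o x le

+-tight : ∀ {u v x y} → u ≤ x → v ≤ y → x + y ≤ u + v → u ≡ x × v ≡ y
+-tight {u} {v} {x} {y} u≤x v≤y x+y≤u+v =
  ≤-antisym u≤x (+-cancelʳ-≤ v x u (≤-trans (+-monoʳ-≤ x v≤y) x+y≤u+v)) ,
  ≤-antisym v≤y (+-cancelˡ-≤ u y v (≤-trans (+-monoˡ-≤ y u≤x) x+y≤u+v))

m+n≤m⇒n≡0 : ∀ m {n} → m + n ≤ m → n ≡ 0
m+n≤m⇒n≡0 m {n} le = n≤0⇒n≡0 (+-cancelˡ-≤ m n 0 (≤-trans le (≤-reflexive (sym (+-identityʳ m)))))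

≤-complement : ∀ {x y x′ y′} → x + y ≡ x′ + y′ → y ≤ y′ → x′ ≤ x
≤-complement {x} {y} {x′} {y′} e y≤y′ =
  +-cancelʳ-≤ y x′ x (≤-trans (+-monoʳ-≤ x′ y≤y′) (≤-reflexive (sym e)))

filter-map-suc : ∀ {p} {P : Pred ℕ p} (P? : Decidable P) ns →
  filter P? (map suc ns) ≡ map suc (filter (λ n → P? (suc n)) ns)
filter-map-suc P? [] = refl
filter-map-suc P? (n ∷ ns) with does (P? (suc n))
... | true  = cong (suc n ∷_) (filter-map-suc P? ns)
... | false = filter-map-suc P? ns

map-↭-++ : ∀ {A B : Set} (f : A → B) {xs} ys zs → xs ↭ ys ++ zs → map f xs ↭ map f ys ++ map f zs
map-↭-++ f ys zs p = ↭-trans (map⁺ f p) (↭-reflexive (map-++ f ys zs))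

length-take-≡ : ∀ {A : Set} k {m} (xs : List A) → length xs ≡ k + m → length (take k xs) ≡ k
length-take-≡ k {m} xs e = trans (length-take k xs) (trans (cong (k ⊓_) e) (m≤n⇒m⊓n≡m (m≤m+n k m)))

length-drop-≡ : ∀ {A : Set} k {m} (xs : List A) → length xs ≡ k + m → length (drop k xs) ≡ m
length-drop-≡ k {m} xs e = trans (length-drop k xs) (trans (cong (_∸ k) e) (m+n∸m≡n k m))

take-length-++ : ∀ {A : Set} (xs ys : List A) → take (length xs) (xs ++ ys) ≡ xs
take-length-++ []       ys = refl
take-length-++ (x ∷ xs) ys = cong (x ∷_) (take-length-++ xs ys)

drop-length-++ : ∀ {A : Set} (xs ys : List A) → drop (length xs) (xs ++ ys) ≡ ys
drop-length-++ []       ys = refl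
drop-length-++ (x ∷ xs) ys = drop-length-++ xs ys

-- Binary digits

data Parity : ℕ → Set where
  even : ∀ x → Parity (x + x)
  odd  : ∀ x → Parity (suc (x + x))

parity : ∀ n → Parity n
parity zero = even 0
parity (suc n) with parity n
... | even x = odd x
... | odd x  = subst Parity (cong suc (+-suc x x)) (even (suc x))

[x+x]%2≡0 : ∀ x → (x + x) % 2 ≡ 0
[x+x]%2≡0 x = trans (cong (_% 2) (x+x≡x*2 x)) (m*n%n≡0 x 2)

[1+x+x]%2≡1 : ∀ x → suc (x + x) % 2 ≡ 1
[1+x+x]%2≡1 x = trans (cong (λ y → suc y % 2) (x+x≡x*2 x)) ([m+kn]%n≡m%n 1 x 2)

[x+x]/2≡x : ∀ x → (x + x) / 2 ≡ x
[x+x]/2≡x x = trans (cong (_/ 2) (x+x≡x*2 x)) (m*n/n≡m x 2)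

[1+x+x]/2≡x : ∀ x → suc (x + x) / 2 ≡ x
[1+x+x]/2≡x x = begin
  suc (x + x) / 2   ≡⟨ cong (λ y → suc y / 2) (x+x≡x*2 x) ⟩
  (1 + x * 2) / 2   ≡⟨ +-distrib-/-∣ʳ 1 {d = 2} (divides-refl x) ⟩
  x * 2 / 2         ≡⟨ m*n/n≡m x 2 ⟩
  x                 ∎
  where open ≡-Reasoning

-- Truncating R at a bound m gives a list that can be computed by recursion on m; R n = onesBelow (suc n) n.
onesBelow : ℕ → ℕ → List ℕ
onesBelow m n = filter (λ ρ → digit n ρ ≟ 1) (upTo m)

upTo-suc : ∀ m → upTo (suc m) ≡ 0 ∷ map suc (upTo m)
upTo-suc m = cong (0 ∷_) (sym (map-upTo suc m))

onesBelow-even : ∀ m {n} x → n ≡ x + x → onesBelow (suc m) n ≡ map suc (onesBelow m x)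
onesBelow-even m x refl = begin
  onesBelow (suc m) (x + x)                        ≡⟨ cong (filter isOne?) (upTo-suc m) ⟩
  filter isOne? (0 ∷ map suc (upTo m))              ≡⟨ filter-reject isOne? {0} {map suc (upTo m)} (λ d≡1 → 0≢1+n (trans (sym ([x+x]%2≡0 x)) d≡1)) ⟩
  filter isOne? (map suc (upTo m))                  ≡⟨ filter-map-suc isOne? (upTo m) ⟩
  map suc (onesBelow m ((x + x) / 2))               ≡⟨ cong (λ k → map suc (onesBelow m k)) ([x+x]/2≡x x) ⟩
  map suc (onesBelow m x)                           ∎
  where open ≡-Reasoning
        isOne? = λ ρ → digit (x + x) ρ ≟ 1

onesBelow-odd : ∀ m {n} x → n ≡ suc (x + x) → onesBelow (suc m) n ≡ 0 ∷ map suc (onesBelow m x)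
onesBelow-odd m x refl = begin
  onesBelow (suc m) (suc (x + x))                  ≡⟨ cong (filter isOne?) (upTo-suc m) ⟩
  filter isOne? (0 ∷ map suc (upTo m))              ≡⟨ filter-accept isOne? {0} {map suc (upTo m)} ([1+x+x]%2≡1 x) ⟩
  0 ∷ filter isOne? (map suc (upTo m))              ≡⟨ cong (0 ∷_) (filter-map-suc isOne? (upTo m)) ⟩
  0 ∷ map suc (onesBelow m (suc (x + x) / 2))       ≡⟨ cong (λ k → 0 ∷ map suc (onesBelow m k)) ([1+x+x]/2≡x x) ⟩
  0 ∷ map suc (onesBelow m x)                       ∎
  where open ≡-Reasoning
        isOne? = λ ρ → digit (suc (x + x)) ρ ≟ 1

onesBelow-stable : ∀ {m n} → n ≤ m → onesBelow (suc m) n ≡ onesBelow m n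
onesBelow-stable {zero} z≤n = refl
onesBelow-stable {suc m} {n} n≤1+m with parity n
... | even x = begin
  onesBelow (suc (suc m)) (x + x)   ≡⟨ onesBelow-even (suc m) x refl ⟩
  map suc (onesBelow (suc m) x)     ≡⟨ cong (map suc) (onesBelow-stable (x+x≤1+m⇒x≤m n≤1+m)) ⟩
  map suc (onesBelow m x)           ≡⟨ onesBelow-even m x refl ⟨
  onesBelow (suc m) (x + x)         ∎
  where open ≡-Reasoning
... | odd x = begin
  onesBelow (suc (suc m)) (suc (x + x))   ≡⟨ onesBelow-odd (suc m) x refl ⟩
  0 ∷ map suc (onesBelow (suc m) x)       ≡⟨ cong (λ ρs → 0 ∷ map suc ρs) (onesBelow-stable (m+n≤o⇒m≤o x (≤-pred n≤1+m))) ⟩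
  0 ∷ map suc (onesBelow m x)             ≡⟨ onesBelow-odd m x refl ⟨
  onesBelow (suc m) (suc (x + x))         ∎
  where open ≡-Reasoning

onesBelow≡R : ∀ {m n} → n ≤ m → onesBelow (suc m) n ≡ R n
onesBelow≡R n≤m = go (≤⇒≤′ n≤m)
  where
  go : ∀ {m n} → n ≤′ m → onesBelow (suc m) n ≡ R n
  go (≤′-reflexive refl) = refl
  go (≤′-step n≤′m)      = trans (onesBelow-stable (m≤n⇒m≤1+n (≤′⇒≤ n≤′m))) (go n≤′m)

#onesBelow : ℕ → ℕ → ℕ
#onesBelow m n = length (onesBelow m n)

#onesBelow-even : ∀ m {n} x → n ≡ x + x → #onesBelow (suc m) n ≡ #onesBelow m x
#onesBelow-even m x refl = trans (cong length (onesBelow-even m x refl)) (length-map suc (onesBelow m x))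

#onesBelow-odd : ∀ m {n} x → n ≡ suc (x + x) → #onesBelow (suc m) n ≡ suc (#onesBelow m x)
#onesBelow-odd m x refl = trans (cong length (onesBelow-odd m x refl)) (cong suc (length-map suc (onesBelow m x)))

private
  even+even : ∀ x y → (x + x) + (y + y) ≡ (x + y) + (x + y)
  even+even = solve-∀
  even+odd : ∀ x y → (x + x) + suc (y + y) ≡ suc ((x + y) + (x + y))
  even+odd = solve-∀
  odd+odd : ∀ x y → suc (x + x) + suc (y + y) ≡ suc (x + y) + suc (x + y)
  odd+odd = solve-∀
  1+odd+even : ∀ x y → suc (suc (x + x) + (y + y)) ≡ suc (x + y) + suc (x + y)
  1+odd+even = solve-∀
  1+even+odd : ∀ x y → suc ((x + x) + suc (y + y)) ≡ suc (x + y) + suc (x + y)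
  1+even+odd = solve-∀

-- Mutual because adding two odd numbers produces a carry.
mutual
  #onesBelow-+-≤ : ∀ m a b → #onesBelow m (a + b) ≤ #onesBelow m a + #onesBelow m b
  #onesBelow-+-≤ zero a b = z≤n
  #onesBelow-+-≤ (suc m) a b with parity a | parity b
  ... | even x | even y
    rewrite #onesBelow-even m (x + y) (even+even x y) | #onesBelow-even m x refl | #onesBelow-even m y refl
    = #onesBelow-+-≤ m x y
  ... | odd x | even y
    rewrite #onesBelow-odd m (x + y) (cong suc (even+even x y)) | #onesBelow-odd m x refl | #onesBelow-even m y refl
    = s≤s (#onesBelow-+-≤ m x y)
  ... | even x | odd y
    rewrite #onesBelow-odd m (x + y) (even+odd x y) | #onesBelow-even m x refl | #onesBelow-odd m y refl
          | +-suc (#onesBelow m x) (#onesBelow m y)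
    = s≤s (#onesBelow-+-≤ m x y)
  ... | odd x | odd y
    rewrite #onesBelow-even m (suc (x + y)) (odd+odd x y)
          | #onesBelow-odd m x refl | #onesBelow-odd m y refl
          | +-suc (#onesBelow m x) (#onesBelow m y)
    = m≤n⇒m≤1+n (#onesBelow-1+-≤ m x y)

  #onesBelow-1+-≤ : ∀ m a b → #onesBelow m (suc (a + b)) ≤ suc (#onesBelow m a + #onesBelow m b)
  #onesBelow-1+-≤ zero a b = z≤n
  #onesBelow-1+-≤ (suc m) a b with parity a | parity b
  ... | even x | even y
    rewrite #onesBelow-odd m (x + y) (cong suc (even+even x y)) | #onesBelow-even m x refl | #onesBelow-even m y refl
    = s≤s (#onesBelow-+-≤ m x y)
  ... | odd x | even y
    rewrite #onesBelow-even m (suc (x + y)) (1+odd+even x y) | #onesBelow-odd m x refl | #onesBelow-even m y refl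
    = m≤n⇒m≤1+n (#onesBelow-1+-≤ m x y)
  ... | even x | odd y
    rewrite #onesBelow-even m (suc (x + y)) (1+even+odd x y) | #onesBelow-even m x refl | #onesBelow-odd m y refl
          | +-suc (#onesBelow m x) (#onesBelow m y)
    = m≤n⇒m≤1+n (#onesBelow-1+-≤ m x y)
  ... | odd x | odd y
    rewrite #onesBelow-odd m (suc (x + y)) (cong suc (odd+odd x y)) | #onesBelow-odd m x refl | #onesBelow-odd m y refl
          | +-suc (#onesBelow m x) (#onesBelow m y)
    = s≤s (m≤n⇒m≤1+n (#onesBelow-1+-≤ m x y))

-- Equality of the counts forces the addition to be carry-free.
#onesBelow-+-≡⇒↭ : ∀ m a b → #onesBelow m (a + b) ≡ #onesBelow m a + #onesBelow m b →
  onesBelow m (a + b) ↭ onesBelow m a ++ onesBelow m b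
#onesBelow-+-≡⇒↭ zero a b _ = ↭-refl
#onesBelow-+-≡⇒↭ (suc m) a b eq with parity a | parity b
... | even x | even y
  rewrite #onesBelow-even m (x + y) (even+even x y) | #onesBelow-even m x refl | #onesBelow-even m y refl
        | onesBelow-even m (x + y) (even+even x y) | onesBelow-even m x refl | onesBelow-even m y refl
  = map-↭-++ suc (onesBelow m x) (onesBelow m y) (#onesBelow-+-≡⇒↭ m x y eq)
... | odd x | even y
  rewrite #onesBelow-odd m (x + y) (cong suc (even+even x y)) | #onesBelow-odd m x refl | #onesBelow-even m y refl
        | onesBelow-odd m (x + y) (cong suc (even+even x y)) | onesBelow-odd m x refl | onesBelow-even m y refl
  = prep 0 (map-↭-++ suc (onesBelow m x) (onesBelow m y) (#onesBelow-+-≡⇒↭ m x y (suc-injective eq)))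
... | even x | odd y
  rewrite #onesBelow-odd m (x + y) (even+odd x y) | #onesBelow-even m x refl | #onesBelow-odd m y refl
        | +-suc (#onesBelow m x) (#onesBelow m y)
        | onesBelow-odd m (x + y) (even+odd x y) | onesBelow-even m x refl | onesBelow-odd m y refl
  = ↭-trans (prep 0 (map-↭-++ suc (onesBelow m x) (onesBelow m y) (#onesBelow-+-≡⇒↭ m x y (suc-injective eq))))
            (↭-sym (shift 0 (map suc (onesBelow m x)) (map suc (onesBelow m y))))
... | odd x | odd y = ⊥-elim (1+n≰n (begin
  suc (suc (#onesBelow m x + #onesBelow m y))                ≡⟨ cong suc (+-suc (#onesBelow m x) (#onesBelow m y)) ⟨
  suc (#onesBelow m x) + suc (#onesBelow m y)                ≡⟨ cong₂ _+_ (#onesBelow-odd m x refl) (#onesBelow-odd m y refl) ⟨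
  #onesBelow (suc m) (suc (x + x)) + #onesBelow (suc m) (suc (y + y)) ≡⟨ eq ⟨
  #onesBelow (suc m) (suc (x + x) + suc (y + y))             ≡⟨ #onesBelow-even m (suc (x + y)) (odd+odd x y) ⟩
  #onesBelow m (suc (x + y))                                 ≤⟨ #onesBelow-1+-≤ m x y ⟩
  suc (#onesBelow m x + #onesBelow m y)                      ∎))
  where open ≤-Reasoning

#onesBelow≡ω : ∀ {m n} → n ≤ m → #onesBelow (suc m) n ≡ ω n
#onesBelow≡ω n≤m = cong length (onesBelow≡R n≤m)

ω-+-≤ : ∀ a b → ω (a + b) ≤ ω a + ω b
ω-+-≤ a b = begin
  ω (a + b)                                      ≡⟨ #onesBelow≡ω {n = a + b} ≤-refl ⟨
  #onesBelow m (a + b)                           ≤⟨ #onesBelow-+-≤ m a b ⟩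
  #onesBelow m a + #onesBelow m b                ≡⟨ cong₂ _+_ (#onesBelow≡ω (m≤m+n a b)) (#onesBelow≡ω (m≤n+m b a)) ⟩
  ω a + ω b                                      ∎
  where open ≤-Reasoning
        m = suc (a + b)

ω-+-≡⇒R-↭ : ∀ a b → ω (a + b) ≡ ω a + ω b → R (a + b) ↭ R a ++ R b
ω-+-≡⇒R-↭ a b eq
  rewrite sym (onesBelow≡R {a + b} ≤-refl)
        | sym (onesBelow≡R {a + b} (m≤m+n a b)) | sym (onesBelow≡R {a + b} (m≤n+m b a))
  = #onesBelow-+-≡⇒↭ (suc (a + b)) a b eq

R-double : ∀ x → R (x + x) ≡ map suc (R x)
R-double x = begin
  R (x + x)                               ≡⟨ onesBelow≡R (n≤1+n (x + x)) ⟨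
  onesBelow (suc (suc (x + x))) (x + x)   ≡⟨ onesBelow-even (suc (x + x)) x refl ⟩
  map suc (onesBelow (suc (x + x)) x)     ≡⟨ cong (map suc) (onesBelow≡R (m≤m+n x x)) ⟩
  map suc (R x)                           ∎
  where open ≡-Reasoning

ω-double : ∀ x → ω (x + x) ≡ ω x
ω-double x = trans (cong length (R-double x)) (length-map suc (R x))

ω≡1⇒R-singleton : ∀ n → ω n ≡ 1 → Σ ℕ λ k → R n ≡ k ∷ []
ω≡1⇒R-singleton n ω≡1 with R n
... | k ∷ [] = k , refl

value : List ℕ → ℕ
value ρs = sum (map (2 ^_) ρs)

value-map-suc : ∀ ρs → value (map suc ρs) ≡ value ρs + value ρs
value-map-suc []       = refl
value-map-suc (ρ ∷ ρs) = trans (cong (2 * 2 ^ ρ +_) (value-map-suc ρs)) (regroup (2 ^ ρ) (value ρs))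
  where
  regroup : ∀ p v → 2 * p + (v + v) ≡ (p + v) + (p + v)
  regroup = solve-∀

value-onesBelow : ∀ {m n} → n ≤ m → value (onesBelow (suc m) n) ≡ n
value-onesBelow {zero} z≤n = refl
value-onesBelow {suc m} {n} n≤1+m with parity n
... | even x = begin
  value (onesBelow (suc (suc m)) (x + x))     ≡⟨ cong value (onesBelow-even (suc m) x refl) ⟩
  value (map suc (onesBelow (suc m) x))       ≡⟨ value-map-suc (onesBelow (suc m) x) ⟩
  value (onesBelow (suc m) x) + value (onesBelow (suc m) x)
                                              ≡⟨ cong (λ v → v + v) (value-onesBelow {n = x} (x+x≤1+m⇒x≤m n≤1+m)) ⟩
  x + x                                       ∎
  where open ≡-Reasoning
... | odd x = begin
  value (onesBelow (suc (suc m)) (suc (x + x)))   ≡⟨ cong value (onesBelow-odd (suc m) x refl) ⟩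
  1 + value (map suc (onesBelow (suc m) x))       ≡⟨ cong suc (value-map-suc (onesBelow (suc m) x)) ⟩
  1 + (value (onesBelow (suc m) x) + value (onesBelow (suc m) x))
                                                  ≡⟨ cong (λ v → suc (v + v)) (value-onesBelow {n = x} (m+n≤o⇒m≤o x (≤-pred n≤1+m))) ⟩
  suc (x + x)                                     ∎
  where open ≡-Reasoning

value-R : ∀ n → value (R n) ≡ n
value-R n = value-onesBelow ≤-refl

1≤ω : ∀ {n} → 1 ≤ n → 1 ≤ ω n
1≤ω {n} 1≤n with R n | value-R n
... | []     | 0≡n = ⊥-elim (<⇒≢ 1≤n 0≡n)
... | _ ∷ _  | _   = s≤s z≤n

-- D-nodes

dNodes : Tree → ℕ
dNodes leaf = 0
dNodes (node l r) with leaves l ≟ leaves r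
... | yes _ = dNodes l + dNodes r
... | no  _ = suc (dNodes l + dNodes r)

suc[sNodes+dNodes]≡leaves : ∀ T → suc (sNodes T + dNodes T) ≡ leaves T
suc[sNodes+dNodes]≡leaves leaf = refl
suc[sNodes+dNodes]≡leaves (node l r) with leaves l ≟ leaves r
... | yes _ = trans (S-regroup (sNodes l) (sNodes r) (dNodes l) (dNodes r))
                    (cong₂ _+_ (suc[sNodes+dNodes]≡leaves l) (suc[sNodes+dNodes]≡leaves r))
  where
  S-regroup : ∀ s t d e → suc (suc (s + t) + (d + e)) ≡ suc (s + d) + suc (t + e)
  S-regroup = solve-∀
... | no _  = trans (D-regroup (sNodes l) (sNodes r) (dNodes l) (dNodes r))
                    (cong₂ _+_ (suc[sNodes+dNodes]≡leaves l) (suc[sNodes+dNodes]≡leaves r))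
  where
  D-regroup : ∀ s t d e → suc ((s + t) + suc (d + e)) ≡ suc (s + d) + suc (t + e)
  D-regroup = solve-∀

sNodes+dNodes-≡ : ∀ T U → leaves T ≡ leaves U → sNodes T + dNodes T ≡ sNodes U + dNodes U
sNodes+dNodes-≡ T U e =
  suc-injective (trans (suc[sNodes+dNodes]≡leaves T) (trans e (sym (suc[sNodes+dNodes]≡leaves U))))

dNodes-≤⇒sNodes-≥ : ∀ T U → leaves T ≡ leaves U → dNodes T ≤ dNodes U → sNodes U ≤ sNodes T
dNodes-≤⇒sNodes-≥ T U e = ≤-complement (sNodes+dNodes-≡ T U e)

sNodes-≥⇒dNodes-≤ : ∀ T U → leaves T ≡ leaves U → sNodes U ≤ sNodes T → dNodes T ≤ dNodes U
sNodes-≥⇒dNodes-≤ T U e = ≤-complement (begin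
  dNodes U + sNodes U   ≡⟨ +-comm (dNodes U) (sNodes U) ⟩
  sNodes U + dNodes U   ≡⟨ sNodes+dNodes-≡ T U e ⟨
  sNodes T + dNodes T   ≡⟨ +-comm (sNodes T) (dNodes T) ⟩
  dNodes T + sNodes T   ∎)
  where open ≡-Reasoning

dNodes-node-≡ : ∀ {l r} → leaves l ≡ leaves r → dNodes (node l r) ≡ dNodes l + dNodes r
dNodes-node-≡ {l} {r} e with leaves l ≟ leaves r
... | yes _ = refl
... | no ne = ⊥-elim (ne e)

dNodes-node-≢ : ∀ {l r} → ¬ leaves l ≡ leaves r → dNodes (node l r) ≡ suc (dNodes l + dNodes r)
dNodes-node-≢ {l} {r} ne with leaves l ≟ leaves r
... | yes e = ⊥-elim (ne e)
... | no _  = refl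

dNodes-node-≤ : ∀ l r → dNodes (node l r) ≤ suc (dNodes l + dNodes r)
dNodes-node-≤ l r with leaves l ≟ leaves r
... | yes _ = n≤1+n _
... | no _  = ≤-refl

dNodes-node-cong : ∀ {l r l′ r′} → leaves l ≡ leaves l′ → leaves r ≡ leaves r′ →
  dNodes l ≡ dNodes l′ → dNodes r ≡ dNodes r′ → dNodes (node l r) ≡ dNodes (node l′ r′)
dNodes-node-cong {l} {r} {l′} {r′} el er dl dr with leaves l ≟ leaves r | leaves l′ ≟ leaves r′
... | yes _ | yes _ = cong₂ _+_ dl dr
... | no _  | no _  = cong suc (cong₂ _+_ dl dr)
... | yes e | no ne = ⊥-elim (ne (trans (sym el) (trans e er)))
... | no ne | yes e = ⊥-elim (ne (trans el (trans e (sym er))))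

dNodes-node-comm : ∀ l r → dNodes (node l r) ≡ dNodes (node r l)
dNodes-node-comm l r with leaves l ≟ leaves r | leaves r ≟ leaves l
... | yes _ | yes _ = +-comm (dNodes l) (dNodes r)
... | no _  | no _  = cong suc (+-comm (dNodes l) (dNodes r))
... | yes e | no ne = ⊥-elim (ne (sym e))
... | no ne | yes e = ⊥-elim (ne (sym e))

leaves-≅ : ∀ {T U} → T ≅ U → leaves T ≡ leaves U
leaves-≅ leaf≅ = refl
leaves-≅ (keep p q) = cong₂ _+_ (leaves-≅ p) (leaves-≅ q)
leaves-≅ {U = node c d} (swap p q) = trans (cong₂ _+_ (leaves-≅ p) (leaves-≅ q)) (+-comm (leaves d) (leaves c))

dNodes-≅ : ∀ {T U} → T ≅ U → dNodes T ≡ dNodes U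
dNodes-≅ leaf≅ = refl
dNodes-≅ {node a b} {node c d} (keep p q) = dNodes-node-cong {a} {b} {c} {d} (leaves-≅ p) (leaves-≅ q) (dNodes-≅ p) (dNodes-≅ q)
dNodes-≅ {node a b} {node c d} (swap p q) =
  trans (dNodes-node-cong {a} {b} {d} {c} (leaves-≅ p) (leaves-≅ q) (dNodes-≅ p) (dNodes-≅ q)) (dNodes-node-comm d c)

≅-refl : ∀ {T} → T ≅ T
≅-refl {leaf}     = leaf≅
≅-refl {node l r} = keep ≅-refl ≅-refl

1≤leaves : ∀ T → 1 ≤ leaves T
1≤leaves leaf       = s≤s z≤n
1≤leaves (node l r) = ≤-trans (1≤leaves l) (m≤m+n (leaves l) (leaves r))

leaves-perfect : ∀ k → leaves (perfect k) ≡ 2 ^ k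
leaves-perfect zero    = refl
leaves-perfect (suc k) = trans (cong₂ _+_ (leaves-perfect k) (leaves-perfect k))
                               (cong (2 ^ k +_) (sym (+-identityʳ (2 ^ k))))

dNodes-perfect : ∀ k → dNodes (perfect k) ≡ 0
dNodes-perfect zero    = refl
dNodes-perfect (suc k) = trans (dNodes-node-≡ {perfect k} refl) (cong₂ _+_ (dNodes-perfect k) (dNodes-perfect k))

sum-leaves-perfect : ∀ ρs → sum (map leaves (map perfect ρs)) ≡ value ρs
sum-leaves-perfect []       = refl
sum-leaves-perfect (ρ ∷ ρs) = cong₂ _+_ (leaves-perfect ρ) (sum-leaves-perfect ρs)

-- Grafting

graft-++ : ∀ Bl Br ts us → length ts ≡ leaves Bl →
  graft (node Bl Br) (ts ++ us) ≡ node (graft Bl ts) (graft Br us)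
graft-++ Bl Br ts us e rewrite sym e =
  cong₂ node (cong (graft Bl) (take-length-++ ts us)) (cong (graft Br) (drop-length-++ ts us))

leaves-graft : ∀ B ts → length ts ≡ leaves B → leaves (graft B ts) ≡ sum (map leaves ts)
leaves-graft leaf (t ∷ []) _ = sym (+-identityʳ (leaves t))
leaves-graft (node l r) ts e = begin
  leaves (graft l (take k ts)) + leaves (graft r (drop k ts))
    ≡⟨ cong₂ _+_ (leaves-graft l (take k ts) (length-take-≡ k ts e)) (leaves-graft r (drop k ts) (length-drop-≡ k ts e)) ⟩
  sum (map leaves (take k ts)) + sum (map leaves (drop k ts))
    ≡⟨ sum-++ (map leaves (take k ts)) (map leaves (drop k ts)) ⟨
  sum (map leaves (take k ts) ++ map leaves (drop k ts))
    ≡⟨ cong sum (map-++ leaves (take k ts) (drop k ts)) ⟨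
  sum (map leaves (take k ts ++ drop k ts))
    ≡⟨ cong (λ us → sum (map leaves us)) (take++drop≡id k ts) ⟩
  sum (map leaves ts) ∎
  where open ≡-Reasoning
        k = leaves l

suc-dNodes-graft-≤ : ∀ B ts → length ts ≡ leaves B → All (λ t → dNodes t ≡ 0) ts →
  suc (dNodes (graft B ts)) ≤ leaves B
suc-dNodes-graft-≤ leaf (t ∷ []) _ (d≡0 ∷ []) = s≤s (≤-reflexive d≡0)
suc-dNodes-graft-≤ (node l r) ts e noD = begin
  suc (dNodes (node gl gr))               ≤⟨ s≤s (dNodes-node-≤ gl gr) ⟩
  suc (suc (dNodes gl + dNodes gr))       ≡⟨ cong suc (+-suc (dNodes gl) (dNodes gr)) ⟨
  suc (dNodes gl) + suc (dNodes gr)       ≤⟨ +-mono-≤ (suc-dNodes-graft-≤ l (take k ts) (length-take-≡ k ts e) (take⁺ k noD))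
                                                      (suc-dNodes-graft-≤ r (drop k ts) (length-drop-≡ k ts e) (drop⁺ k noD)) ⟩
  leaves l + leaves r                     ∎
  where open ≤-Reasoning
        k  = leaves l
        gl = graft l (take k ts)
        gr = graft r (drop k ts)

graft-singleton : ∀ B {ts t} → leaves B ≡ 1 → ts ↭ t ∷ [] → graft B ts ≡ t
graft-singleton leaf _ p rewrite ↭-singleton-inv p = refl
graft-singleton (node l r) e _ =
  ⊥-elim (1+n≰n (≤-trans (+-mono-≤ (1≤leaves l) (1≤leaves r)) (≤-reflexive e)))

treeWithLeaves : ∀ {k} → 1 ≤ k → Σ Tree λ B → leaves B ≡ k
treeWithLeaves {suc zero}    _ = leaf , refl
treeWithLeaves {suc (suc k)} _ with treeWithLeaves {suc k} (s≤s z≤n)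
... | B , e = node leaf B , cong suc e

-- Optimal trees

ω≤suc-dNodes : ∀ T → ω (leaves T) ≤ suc (dNodes T)
ω≤suc-dNodes leaf = ≤-refl
ω≤suc-dNodes (node l r) with leaves l ≟ leaves r
... | yes e = begin
  ω (leaves l + leaves r)   ≡⟨ cong (λ b → ω (leaves l + b)) e ⟨
  ω (leaves l + leaves l)   ≡⟨ ω-double (leaves l) ⟩
  ω (leaves l)              ≤⟨ ω≤suc-dNodes l ⟩
  suc (dNodes l)            ≤⟨ s≤s (m≤m+n (dNodes l) (dNodes r)) ⟩
  suc (dNodes l + dNodes r) ∎
  where open ≤-Reasoning
... | no _ = begin
  ω (leaves l + leaves r)       ≤⟨ ω-+-≤ (leaves l) (leaves r) ⟩
  ω (leaves l) + ω (leaves r)   ≤⟨ +-mono-≤ (ω≤suc-dNodes l) (ω≤suc-dNodes r) ⟩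
  suc (dNodes l) + suc (dNodes r) ≡⟨ cong suc (+-suc (dNodes l) (dNodes r)) ⟩
  suc (suc (dNodes l + dNodes r)) ∎
  where open ≤-Reasoning

Optimal : Tree → Set
Optimal T = ω (leaves T) ≡ suc (dNodes T)

optimal-children-≢ : ∀ {l r} → ¬ leaves l ≡ leaves r → Optimal (node l r) →
  Optimal l × Optimal r × ω (leaves l + leaves r) ≡ ω (leaves l) + ω (leaves r)
optimal-children-≢ {l} {r} ne opt = optˡ , optʳ , trans opt′ (sym (cong₂ _+_ optˡ optʳ))
  where
  opt′ : ω (leaves l + leaves r) ≡ suc (dNodes l) + suc (dNodes r)
  opt′ = trans opt (cong suc (trans (dNodes-node-≢ {l} {r} ne) (sym (+-suc (dNodes l) (dNodes r)))))
  tight = +-tight (ω≤suc-dNodes l) (ω≤suc-dNodes r)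
            (≤-trans (≤-reflexive (sym opt′)) (ω-+-≤ (leaves l) (leaves r)))
  optˡ = proj₁ tight
  optʳ = proj₂ tight

-- Since ω (a + a) = ω a, either child alone already accounts for the whole bound.
optimal-children-≡ : ∀ {l r} → leaves l ≡ leaves r → Optimal (node l r) →
  Optimal l × Optimal r × ω (leaves l) ≡ 1
optimal-children-≡ {l} {r} e opt = optˡ , optʳ , trans opt′ (cong suc (cong₂ _+_ dˡ≡0 dʳ≡0))
  where
  opt′ : ω (leaves l) ≡ suc (dNodes l + dNodes r)
  opt′ = trans (sym (trans (cong (λ b → ω (leaves l + b)) (sym e)) (ω-double (leaves l))))
               (trans opt (cong suc (dNodes-node-≡ {l} {r} e)))
  dʳ≡0 : dNodes r ≡ 0
  dʳ≡0 = m+n≤m⇒n≡0 (dNodes l) (≤-pred (≤-trans (≤-reflexive (sym opt′)) (ω≤suc-dNodes l)))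
  dˡ≡0 : dNodes l ≡ 0
  dˡ≡0 = m+n≤m⇒n≡0 (dNodes r) (≤-pred (begin
    suc (dNodes r + dNodes l) ≡⟨ cong suc (+-comm (dNodes r) (dNodes l)) ⟩
    suc (dNodes l + dNodes r) ≡⟨ opt′ ⟨
    ω (leaves l)              ≡⟨ cong ω e ⟩
    ω (leaves r)              ≤⟨ ω≤suc-dNodes r ⟩
    suc (dNodes r)            ∎))
    where open ≤-Reasoning
  optˡ : Optimal l
  optˡ = trans opt′ (cong suc (trans (cong (dNodes l +_) dʳ≡0) (+-identityʳ (dNodes l))))
  optʳ : Optimal r
  optʳ = trans (cong ω (sym e)) (trans opt′ (cong (λ d → suc (d + dNodes r)) dˡ≡0))

PerfectGraft : ℕ → Tree → Set
PerfectGraft n T = Σ Tree λ B → Σ (List Tree) λ ts →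
  leaves B ≡ ω n × ts ↭ map perfect (R n) × T ≅ graft B ts

length-perfects : ∀ {ts ρs} → ts ↭ map perfect ρs → length ts ≡ length ρs
length-perfects {ρs = ρs} p = trans (↭-length p) (length-map perfect ρs)

perfectGraft⇒optimal : ∀ T → PerfectGraft (leaves T) T → Optimal T
perfectGraft⇒optimal T (B , ts , eB , p , T≅) = ≤-antisym (ω≤suc-dNodes T) (begin
  suc (dNodes T)            ≡⟨ cong suc (dNodes-≅ T≅) ⟩
  suc (dNodes (graft B ts)) ≤⟨ suc-dNodes-graft-≤ B ts (trans (length-perfects p) (sym eB)) noD ⟩
  leaves B                  ≡⟨ eB ⟩
  ω (leaves T)              ∎)
  where
  open ≤-Reasoning
  noD : All (λ t → dNodes t ≡ 0) ts
  noD = All-resp-↭ (↭-sym p) (All-map⁺ (universal dNodes-perfect (R (leaves T))))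

optimal-exists : ∀ {n} → 1 ≤ n → Σ Tree λ W → leaves W ≡ n × Optimal W
optimal-exists {n} 1≤n = W , leavesW , perfectGraft⇒optimal W (subst (λ m → PerfectGraft m W) (sym leavesW) graftW)
  where
  B  = proj₁ (treeWithLeaves (1≤ω 1≤n))
  eB = proj₂ (treeWithLeaves (1≤ω 1≤n))
  ts = map perfect (R n)
  W  = graft B ts
  leavesW : leaves W ≡ n
  leavesW = begin
    leaves (graft B ts)   ≡⟨ leaves-graft B ts (trans (length-map perfect (R n)) (sym eB)) ⟩
    sum (map leaves ts)   ≡⟨ sum-leaves-perfect (R n) ⟩
    value (R n)           ≡⟨ value-R n ⟩
    n                     ∎
    where open ≡-Reasoning
  graftW : PerfectGraft n W
  graftW = B , ts , eB , ↭-refl , ≅-refl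

perfectGraft-node-+ : ∀ a b {l r} → PerfectGraft a l → PerfectGraft b r → ω (a + b) ≡ ω a + ω b →
  PerfectGraft (a + b) (node l r)
perfectGraft-node-+ a b {l} {r} (Bl , tsl , eBl , pl , l≅) (Br , tsr , eBr , pr , r≅) ω+ =
  node Bl Br , tsl ++ tsr , trans (cong₂ _+_ eBl eBr) (sym ω+) , perm , node≅
  where
  open PermutationReasoning
  perm : tsl ++ tsr ↭ map perfect (R (a + b))
  perm = begin
    tsl ++ tsr                            ↭⟨ ++⁺ pl pr ⟩
    map perfect (R a) ++ map perfect (R b) ≡⟨ map-++ perfect (R a) (R b) ⟨
    map perfect (R a ++ R b)              ↭⟨ map⁺ perfect (↭-sym (ω-+-≡⇒R-↭ a b ω+)) ⟩
    map perfect (R (a + b))               ∎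
  node≅ : node l r ≅ graft (node Bl Br) (tsl ++ tsr)
  node≅ = subst (node l r ≅_) (sym (graft-++ Bl Br tsl tsr (trans (length-perfects pl) (sym eBl)))) (keep l≅ r≅)

perfectGraft-singleton : ∀ a {T k} → PerfectGraft a T → R a ≡ k ∷ [] → T ≅ perfect k
perfectGraft-singleton a {T} (B , ts , eB , p , T≅) Ra≡[k] =
  subst (T ≅_) (graft-singleton B (trans eB (cong length Ra≡[k])) (subst (λ ρs → ts ↭ map perfect ρs) Ra≡[k] p)) T≅

perfectGraft-node-≡ : ∀ a b {l r} → PerfectGraft a l → PerfectGraft b r → a ≡ b → ω a ≡ 1 →
  PerfectGraft (a + b) (node l r)
perfectGraft-node-≡ a .a {l} {r} gl gr refl ω≡1 with ω≡1⇒R-singleton a ω≡1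
... | k , Ra≡[k] =
  leaf , perfect (suc k) ∷ [] , sym (trans (ω-double a) ω≡1) ,
  ↭-reflexive (sym (cong (map perfect) (trans (R-double a) (cong (map suc) Ra≡[k])))) ,
  keep (perfectGraft-singleton a gl Ra≡[k]) (perfectGraft-singleton a gr Ra≡[k])

optimal⇒perfectGraft : ∀ T → Optimal T → PerfectGraft (leaves T) T
optimal⇒perfectGraft leaf _ = leaf , perfect 0 ∷ [] , refl , ↭-refl , leaf≅
optimal⇒perfectGraft (node l r) opt = byChildren (leaves l ≟ leaves r)
  where
  byChildren : Dec (leaves l ≡ leaves r) → PerfectGraft (leaves l + leaves r) (node l r)
  byChildren (yes e) =
    let optˡ , optʳ , ω≡1 = optimal-children-≡ {l} {r} e opt
    in perfectGraft-node-≡ (leaves l) (leaves r) (optimal⇒perfectGraft l optˡ) (optimal⇒perfectGraft r optʳ) e ω≡1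
  byChildren (no ne) =
    let optˡ , optʳ , ω+ = optimal-children-≢ {l} {r} ne opt
    in perfectGraft-node-+ (leaves l) (leaves r) (optimal⇒perfectGraft l optˡ) (optimal⇒perfectGraft r optʳ) ω+

optimal⇒maxS : ∀ T → Optimal T → MaxS (leaves T) T
optimal⇒maxS T opt U leavesU = dNodes-≤⇒sNodes-≥ T U (sym leavesU) (≤-pred (begin
  suc (dNodes T)  ≡⟨ opt ⟨
  ω (leaves T)    ≡⟨ cong ω leavesU ⟨
  ω (leaves U)    ≤⟨ ω≤suc-dNodes U ⟩
  suc (dNodes U)  ∎))
  where open ≤-Reasoning

maxS⇒optimal : ∀ T → 1 ≤ leaves T → MaxS (leaves T) T → Optimal T
maxS⇒optimal T 1≤n maxS with optimal-exists 1≤n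
... | W , leavesW , optW = ≤-antisym (ω≤suc-dNodes T) (begin
  suc (dNodes T)  ≤⟨ s≤s (sNodes-≥⇒dNodes-≤ T W (sym leavesW) (maxS W leavesW)) ⟩
  suc (dNodes W)  ≡⟨ optW ⟨
  ω (leaves W)    ≡⟨ cong ω leavesW ⟩
  ω (leaves T)    ∎)
  where open ≤-Reasoning

theorem77 : (n : ℕ) → 1 ≤ n → (T : Tree) → leaves T ≡ n →
    (MaxS n T ⇔ Σ Tree (λ B → Σ (List Tree) (λ ts →
        leaves B ≡ ω n × ts ↭ map perfect (R n) × T ≅ graft B ts)))
theorem77 .(leaves T) 1≤n T refl =
  mk⇔ (optimal⇒perfectGraft T ∘ maxS⇒optimal T 1≤n) (optimal⇒maxS T ∘ perfectGraft⇒optimal T)
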